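{- Let $n \ge 2$. Let $\pi_1,\pi_2,\pi_3$ be permutations of $\{1,\ldots,n^2\}$, let $0\le k\le n^2$, let $\{i_1,\ldots,i_k\}\subset\{1,\ldots,n^2\}$ be an index set and let $g_{i_1},\ldots,g_{i_k}\in\mathbb{Z}$ with $1\le g_{i_l}\le n$ for $l=1,\ldots,k$. Let $x\in\mathbb{Z}^{n^2}$ be a solution of the generalized Sudoku problem with these data, i.e. $1\le x_i\le n$ for all $i=1,\ldots,n^2$, $A_{\pi_r}x <> \mathbf{0}$ for $r=1,2,3$, and $x_{i_l}=g_{i_l}$ for $l=1,\ldots,k$. Then \[ x = \frac{1}{2}\left( A_{\pi_r}^T\, \mathrm{sgn}(A_{\pi_r} x) + (n+1)\mathbf{1}_{n^2}\right) \] for each $r=1,2,3$.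
   Context: For $n\ge 1$ let $s(n)=\sum_{i=1}^{n-1} i = n(n-1)/2$. The matrix $A(n)$ is the $s(n)\times n$ integer matrix whose rows are indexed by the pairs $(i,j)$ with $1\le i<j\le n$, taken in lexicographic order $(1,2),(1,3),\ldots,(1,n),(2,3),\ldots,(n-1,n)$; the row for $(i,j)$ has entry $+1$ in column $i$, entry $-1$ in column $j$, and $0$ elsewhere (so $A(n)x$ has components $x_i-x_j$, $i<j$, in this order). The matrix $A$ is the $n\,s(n)\times n^2$ block diagonal matrix with $n$ diagonal blocks each equal to $A(n)$ and zeros elsewhere. For a permutation $\pi$ of $\{1,\ldots,n^2\}$, $A_\pi$ is the matrix whose $j$-th column is the $\pi^{ -1}(j)$-th column of $A$, for $j=1,\ldots,n^2$. For $y\in\mathbb{Z}^s$ we write $y<>\mathbf{0}$ if every component of $y$ is nonzero. For such $y$, $\mathrm{sgn}(y)$ denotes the vector $(\mathrm{sgn}(y_1),\ldots,\mathrm{sgn}(y_s))^T$ of componentwise signs. $\mathbf{1}_m$ is the all-ones vector in $\mathbb{Z}^m$. -}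

module Defs where

open import Data.Nat as ℕ using (ℕ; zero; suc)
open import Data.Integer as ℤ using (ℤ; +_; -[1+_]; 0ℤ; 1ℤ; -1ℤ)
open import Data.Fin using (Fin; remQuot; _<?_)
open import Data.Fin.Properties using () renaming (_≟_ to _≟ᶠ_)
open import Data.Fin.Permutation using (Permutation′; _⟨$⟩ˡ_)
open import Data.List using (List; []; _∷_; map; concatMap; filter; allFin; foldr; zipWith; length)
open import Data.Product using (_×_; _,_; proj₁; proj₂)
open import Relation.Nullary using (yes; no)

s : ℕ → ℕ
s n = (n ℕ.* (n ℕ.∸ 1)) ℕ./ 2

-- A matrix with c columns is represented by the list of its rows (in order);
-- a row is a function Fin c → ℤ.  Column index j ∈ Fin c corresponds to j+1.
Matrix : ℕ → Set
Matrix c = List (Fin c → ℤ)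

pairs : (n : ℕ) → List (Fin n × Fin n)
pairs n = concatMap (λ i → map (λ j → (i , j)) (filter (λ j → i <? j) (allFin n))) (allFin n)

pairRow : {n : ℕ} → Fin n × Fin n → Fin n → ℤ
pairRow (i , j) c with c ≟ᶠ i
... | yes _ = 1ℤ
... | no _ with c ≟ᶠ j
...   | yes _ = -1ℤ
...   | no _ = 0ℤ

A[_] : (n : ℕ) → Matrix n
A[ n ] = map pairRow (pairs n)

-- Embed a row of the b-th diagonal block into n*n columns
-- (column c ∈ Fin (n*n) is in block quotient c with local index remainder c).
blockRow : {n : ℕ} → Fin n → (Fin n → ℤ) → Fin (n ℕ.* n) → ℤ
blockRow {n} b r c with remQuot n c
... | (b' , m) with b' ≟ᶠ b
...   | yes _ = r m
...   | no _ = 0ℤ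

A : (n : ℕ) → Matrix (n ℕ.* n)
A n = concatMap (λ b → map (blockRow b) A[ n ]) (allFin n)

-- A_π: j-th column is the π⁻¹(j)-th column of A
Aπ : (n : ℕ) → Permutation′ (n ℕ.* n) → Matrix (n ℕ.* n)
Aπ n π = map (λ r j → r (π ⟨$⟩ˡ j)) (A n)

sumℤ : List ℤ → ℤ
sumℤ = foldr ℤ._+_ 0ℤ

Σ : {c : ℕ} → (Fin c → ℤ) → ℤ
Σ {c} f = sumℤ (map f (allFin c))

_·_ : {c : ℕ} → Matrix c → (Fin c → ℤ) → List ℤ
M · x = map (λ r → Σ (λ j → r j ℤ.* x j)) M

_ᵀ·_ : {c : ℕ} → Matrix c → List ℤ → Fin c → ℤ
(M ᵀ· y) j = sumℤ (zipWith (λ r yr → r j ℤ.* yr) M y)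

sgn : ℤ → ℤ
sgn (+ zero) = 0ℤ
sgn (+ suc _) = 1ℤ
sgn -[1+ _ ] = -1ℤ

sgnV : List ℤ → List ℤ
sgnV = map sgn

-- Inside a block of A, the row for the pair (i,k) applied to x is z_i - z_k, where z lists the
-- entries of x that the column permutation places in that block.  Nonvanishing of A_π x therefore
-- makes z injective, and together with 1 <= z_t <= n this makes z a permutation of 1..n.  The
-- entry of A_π^T sgn(A_π x) at the position of z_m collects sgn(z_m - z_t) over the block, and for a
-- permutation of 1..n this sum is (z_m - 1) - (n - z_m) = 2 z_m - n - 1.

module Submission where

open import Defs
open import Data.Nat as ℕ using (ℕ; zero; suc; s≤s)
open import Data.Nat.Properties as ℕP using ()
open import Data.Integer as ℤ using (ℤ; +_; -[1+_]; 0ℤ; 1ℤ; -1ℤ; _+_; _-_; _*_; -_)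
open import Data.Integer.Properties as ℤP using ()
open import Data.Integer.Tactic.RingSolver using (solve-∀)
open import Data.Fin as Fin
  using (Fin; zero; suc; toℕ; fromℕ<; combine; remQuot; punchIn; punchOut; _↑ˡ_; _↑ʳ_; _<?_)
open import Data.Fin.Properties as FinP using (any?) renaming (_≟_ to _≟ᶠ_)
open import Data.Fin.Permutation as Perm using (Permutation′; _⟨$⟩ʳ_; _⟨$⟩ˡ_)
open import Data.Fin.Subset using (Subset; _∈_)
open import Data.List as List using (List; []; _∷_; map; concatMap; filter; allFin)
open import Data.List.Properties
  using (map-tabulate; map-++; map-∘; map-cong; map-cong-local; map-concatMap; concatMap-cong)
open import Data.List.Relation.Unary.All as All using (All; []; _∷_)
import Data.List.Relation.Unary.All.Properties as AllP
open import Data.List.Membership.Propositional using (lose) renaming (_∈_ to _∈ₗ_)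
open import Data.List.Membership.Propositional.Properties
  using (∈-concatMap⁺; ∈-map⁺; ∈-filter⁺; ∈-allFin)
open import Data.Product using (_×_; _,_; proj₁; proj₂; ∃)
open import Data.Sum using (inj₁; inj₂)
open import Function using (_∘_; id)
open import Function.Definitions using (Injective)
open import Relation.Nullary using (Dec; yes; no; ¬_; contradiction)
open import Relation.Unary using (Decidable)
open import Relation.Binary.PropositionalEquality
open import Relation.Binary.Definitions using (tri<; tri≈; tri>)
open ≡-Reasoning

open import Algebra.Properties.CommutativeMonoid.Sum ℤP.+-0-commutativeMonoid
  using (sum; sum-cong-≗; sum-replicate-zero; sum-remove; sum-init-last; sum-permute; ∑-distrib-+)

variable
  k n : ℕ

-- Finite sums

sumℤ-++ : ∀ xs ys → sumℤ (xs List.++ ys) ≡ sumℤ xs + sumℤ ys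
sumℤ-++ []       ys = sym (ℤP.+-identityˡ _)
sumℤ-++ (x ∷ xs) ys = trans (cong (λ q → x + q) (sumℤ-++ xs ys)) (sym (ℤP.+-assoc x _ _))

sumℤ-concatMap : ∀ {A B : Set} (f : B → ℤ) (g : A → List B) xs →
                 sumℤ (map f (concatMap g xs)) ≡ sumℤ (map (λ a → sumℤ (map f (g a))) xs)
sumℤ-concatMap f g []       = refl
sumℤ-concatMap f g (x ∷ xs) = begin
  sumℤ (map f (g x List.++ concatMap g xs))            ≡⟨ cong sumℤ (map-++ f (g x) _) ⟩
  sumℤ (map f (g x) List.++ map f (concatMap g xs))    ≡⟨ sumℤ-++ (map f (g x)) _ ⟩
  sumℤ (map f (g x)) + sumℤ (map f (concatMap g xs))
    ≡⟨ cong (λ q → sumℤ (map f (g x)) + q) (sumℤ-concatMap f g xs) ⟩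
  sumℤ (map (λ a → sumℤ (map f (g a))) (x ∷ xs))       ∎

infixl 7 _when_
_when_ : {P : Set} → ℤ → Dec P → ℤ
a when yes _ = a
a when no  _ = 0ℤ

when-yes : ∀ {P : Set} {a : ℤ} (d : Dec P) → P → a when d ≡ a
when-yes (yes _) _  = refl
when-yes (no ¬p) p  = contradiction p ¬p

when-no : ∀ {P : Set} {a : ℤ} (d : Dec P) → ¬ P → a when d ≡ 0ℤ
when-no (yes p) ¬p = contradiction p ¬p
when-no (no _)  _  = refl

0-when : ∀ {P : Set} (d : Dec P) → 0ℤ when d ≡ 0ℤ
0-when (yes _) = refl
0-when (no _)  = refl

sumℤ-filter : ∀ {A : Set} {P : A → Set} (P? : Decidable P) (f : A → ℤ) xs →
              sumℤ (map f (filter P? xs)) ≡ sumℤ (map (λ a → f a when P? a) xs)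
sumℤ-filter P? f []       = refl
sumℤ-filter P? f (x ∷ xs) with P? x
... | yes _ = cong (λ q → f x + q) (sumℤ-filter P? f xs)
... | no  _ = trans (sumℤ-filter P? f xs) (sym (ℤP.+-identityˡ _))

sumℤ-map-0 : ∀ {A : Set} {f : A → ℤ} xs → (∀ a → f a ≡ 0ℤ) → sumℤ (map f xs) ≡ 0ℤ
sumℤ-map-0 []       f≡0 = refl
sumℤ-map-0 (x ∷ xs) f≡0 = cong₂ _+_ (f≡0 x) (sumℤ-map-0 xs f≡0)

sumℤ-map-+ : ∀ {A : Set} (f g : A → ℤ) xs →
             sumℤ (map (λ a → f a + g a) xs) ≡ sumℤ (map f xs) + sumℤ (map g xs)
sumℤ-map-+ f g []       = refl
sumℤ-map-+ f g (x ∷ xs) =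
  trans (cong (λ q → f x + g x + q) (sumℤ-map-+ f g xs)) (interchange (f x) (g x) _ _)
  where
  interchange : ∀ a b c d → a + b + (c + d) ≡ a + c + (b + d)
  interchange = solve-∀

sumℤ-tabulate : (f : Fin n → ℤ) → sumℤ (List.tabulate f) ≡ sum f
sumℤ-tabulate {zero}  f = refl
sumℤ-tabulate {suc n} f = cong (λ q → f zero + q) (sumℤ-tabulate (f ∘ suc))

Σ≡sum : (f : Fin n → ℤ) → Σ f ≡ sum f
Σ≡sum f = trans (cong sumℤ (map-tabulate id f)) (sumℤ-tabulate f)

∑-zero : {f : Fin n → ℤ} → (∀ i → f i ≡ 0ℤ) → sum f ≡ 0ℤ
∑-zero {n} f≡0 = trans (sum-cong-≗ f≡0) (sum-replicate-zero n)

∑-point : {f : Fin n → ℤ} (p : Fin n) → (∀ i → i ≢ p → f i ≡ 0ℤ) → sum f ≡ f p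
∑-point {suc n} {f} p vanish = begin
  sum f                     ≡⟨ sum-remove {i = p} f ⟩
  f p + sum (f ∘ punchIn p) ≡⟨ cong (λ q → f p + q) (∑-zero (λ j → vanish (punchIn p j) (FinP.punchInᵢ≢i p j))) ⟩
  f p + 0ℤ                  ≡⟨ ℤP.+-identityʳ (f p) ⟩
  f p                       ∎

∑-two : {f : Fin n → ℤ} {p q : Fin n} → p ≢ q → (∀ i → i ≢ p → i ≢ q → f i ≡ 0ℤ) →
        sum f ≡ f p + f q
∑-two {suc n} {f} {p} {q} p≢q vanish = begin
  sum f                                       ≡⟨ sum-remove {i = p} f ⟩
  f p + sum (f ∘ punchIn p)                   ≡⟨ cong (λ r → f p + r) (∑-point (punchOut p≢q) vanish′) ⟩
  f p + f (punchIn p (punchOut p≢q))          ≡⟨ cong (λ i → f p + f i) (FinP.punchIn-punchOut p≢q) ⟩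
  f p + f q                                   ∎
  where
  vanish′ : ∀ j → j ≢ punchOut p≢q → f (punchIn p j) ≡ 0ℤ
  vanish′ j j≢ = vanish (punchIn p j) (FinP.punchInᵢ≢i p j)
    (λ e → j≢ (trans (sym (FinP.punchOut-punchIn p)) (FinP.punchOut-cong p e)))

∑-↑ : ∀ {k n} (f : Fin (k ℕ.+ n) → ℤ) → sum f ≡ sum (f ∘ (_↑ˡ n)) + sum (f ∘ (k ↑ʳ_))
∑-↑ {zero}  f = sym (ℤP.+-identityˡ _)
∑-↑ {suc k} {n} f = trans (cong (λ q → f zero + q) (∑-↑ {k} {n} (f ∘ suc))) (sym (ℤP.+-assoc (f zero) _ _))

∑-combine : ∀ {k n} (f : Fin (k ℕ.* n) → ℤ) → sum f ≡ sum (λ b → sum (λ m → f (combine {k} {n} b m)))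
∑-combine {zero}      f = refl
∑-combine {suc k} {n} f = trans (∑-↑ {n} {k ℕ.* n} f)
  (cong (λ q → sum (f ∘ (_↑ˡ k ℕ.* n)) + q) (∑-combine {k} {n} (f ∘ (n ↑ʳ_))))

injective⇒surjective : {τ : Fin n → Fin n} → Injective _≡_ _≡_ τ → ∀ u → ∃ λ t → τ t ≡ u
injective⇒surjective {suc n} {τ} τ-inj u with any? (λ t → τ t ≟ᶠ u)
... | yes hit = hit
... | no miss = contradiction (FinP.injective⇒≤ punched-injective) ℕP.1+n≰n
  where
  u≢τ : ∀ t → u ≢ τ t
  u≢τ t u≡τt = miss (t , sym u≡τt)
  punched : Fin (suc n) → Fin n
  punched t = punchOut (u≢τ t)
  punched-injective : Injective _≡_ _≡_ punched
  punched-injective {t} {t′} e = τ-inj (FinP.punchOut-injective (u≢τ t) (u≢τ t′) e)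

∑-reindex : {τ : Fin n → Fin n} → Injective _≡_ _≡_ τ → (f : Fin n → ℤ) → sum (f ∘ τ) ≡ sum f
∑-reindex {n} {τ} τ-inj f = sym (sum-permute f (Perm.permutation τ τ⁻¹ τ∘τ⁻¹ τ⁻¹∘τ))
  where
  τ⁻¹ : Fin n → Fin n
  τ⁻¹ u = proj₁ (injective⇒surjective τ-inj u)
  τ∘τ⁻¹ : ∀ u → τ (τ⁻¹ u) ≡ u
  τ∘τ⁻¹ u = proj₂ (injective⇒surjective τ-inj u)
  τ⁻¹∘τ : ∀ t → τ⁻¹ (τ t) ≡ t
  τ⁻¹∘τ t = τ-inj (τ∘τ⁻¹ (τ t))

∑-split-around : (f : Fin n → ℤ) (m : Fin n) → f m ≡ 0ℤ →
                 sum (λ t → f t when (m <? t)) + sum (λ t → f t when (t <? m)) ≡ sum f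
∑-split-around {n} f m fm≡0 =
  trans (sym (∑-distrib-+ (λ t → f t when (m <? t)) (λ t → f t when (t <? m)))) (sum-cong-≗ {n} split)
  where
  split : ∀ t → f t when (m <? t) + f t when (t <? m) ≡ f t
  split t with FinP.<-cmp m t
  ... | tri< m<t _ t≮m  = trans (cong₂ _+_ (when-yes (m <? t) m<t) (when-no (t <? m) t≮m)) (ℤP.+-identityʳ (f t))
  ... | tri> m≮t _ t<m  = trans (cong₂ _+_ (when-no (m <? t) m≮t) (when-yes (t <? m) t<m)) (ℤP.+-identityˡ (f t))
  ... | tri≈ m≮m refl _ = trans (cong₂ _+_ (when-no (m <? m) m≮m) (when-no (m <? m) m≮m)) (sym fm≡0)

-- Signs

sgn-neg : ∀ y → sgn (- y) ≡ - sgn y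
sgn-neg (+ zero)  = refl
sgn-neg (+ suc _) = refl
sgn-neg -[1+ _ ]  = refl

sgn-antisym : ∀ a b → sgn (b - a) ≡ - sgn (a - b)
sgn-antisym a b = trans (cong sgn (swap a b)) (sgn-neg (a - b))
  where
  swap : ∀ a b → b - a ≡ - (a - b)
  swap = solve-∀

sgn-[a-a]≡0 : ∀ a → sgn (a - a) ≡ 0ℤ
sgn-[a-a]≡0 a = cong sgn (ℤP.+-inverseʳ a)

sgn-⊖-> : ∀ {m n} → n ℕ.< m → sgn (m ℤ.⊖ n) ≡ 1ℤ
sgn-⊖-> {m} {n} n<m rewrite ℤP.⊖-≥ (ℕP.<⇒≤ n<m) with m ℕ.∸ n | ℕP.m>n⇒m∸n≢0 n<m
... | zero  | m∸n≢0 = contradiction refl m∸n≢0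
... | suc _ | _     = refl

sgn-[+m]-[+n]≡1 : ∀ {m n} → n ℕ.< m → sgn (+ m - + n) ≡ 1ℤ
sgn-[+m]-[+n]≡1 {m} {n} n<m = trans (cong sgn (ℤP.[+m]-[+n]≡m⊖n m n)) (sgn-⊖-> n<m)

sgn-[+m]-[+n]≡-1 : ∀ {m n} → m ℕ.< n → sgn (+ m - + n) ≡ -1ℤ
sgn-[+m]-[+n]≡-1 {m} {n} m<n = begin
  sgn (+ m - + n)     ≡⟨ cong sgn (trans (ℤP.[+m]-[+n]≡m⊖n m n) (ℤP.⊖-swap m n)) ⟩
  sgn (- (n ℤ.⊖ m))   ≡⟨ sgn-neg (n ℤ.⊖ m) ⟩
  - sgn (n ℤ.⊖ m)     ≡⟨ cong -_ (sgn-⊖-> m<n) ⟩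
  -1ℤ                 ∎

sgnSum : ℕ → (n : ℕ) → ℤ
sgnSum b n = sum {n} (λ u → sgn (+ b - + suc (toℕ u)))

sgnSum-step : ∀ b n → sgnSum b (suc n) ≡ sgnSum b n + sgn (+ b - + suc n)
sgnSum-step b n = trans (sum-init-last {n} (λ u → sgn (+ b - + suc (toℕ u))))
  (cong₂ _+_ (sum-cong-≗ {n} (λ u → cong (λ i → sgn (+ b - + suc i)) (FinP.toℕ-inject₁ u)))
             (cong (λ i → sgn (+ b - + suc i)) (FinP.toℕ-fromℕ n)))

sgnSum-above : ∀ {b n} → n ℕ.< b → sgnSum b n ≡ + n
sgnSum-above {b} {zero}  _   = refl
sgnSum-above {b} {suc n} n<b = begin
  sgnSum b (suc n)                 ≡⟨ sgnSum-step b n ⟩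
  sgnSum b n + sgn (+ b - + suc n) ≡⟨ cong₂ _+_ (sgnSum-above (ℕP.<-trans (ℕP.n<1+n n) n<b)) (sgn-[+m]-[+n]≡1 n<b) ⟩
  + n + 1ℤ                         ≡⟨ cong +_ (ℕP.+-comm n 1) ⟩
  + suc n                          ∎

sgnSum-within : ∀ {a n} → a ℕ.< n → + 2 * + suc a ≡ sgnSum (suc a) n + + suc n
sgnSum-within {a} {suc n} (s≤s a≤n) with ℕP.m≤n⇒m<n∨m≡n a≤n
... | inj₁ a<n = begin
  + 2 * + suc a
    ≡⟨ sgnSum-within a<n ⟩
  sgnSum (suc a) n + + suc n
    ≡⟨ shift (sgnSum (suc a) n) (+ n) ⟩
  sgnSum (suc a) n + -1ℤ + + suc (suc n)
    ≡⟨ cong (λ σ → sgnSum (suc a) n + σ + + suc (suc n)) (sgn-[+m]-[+n]≡-1 (s≤s a<n)) ⟨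
  sgnSum (suc a) n + sgn (+ suc a - + suc n) + + suc (suc n)
    ≡⟨ cong (_+ + suc (suc n)) (sgnSum-step (suc a) n) ⟨
  sgnSum (suc a) (suc n) + + suc (suc n) ∎
  where
  shift : ∀ S k → S + (1ℤ + k) ≡ S + -1ℤ + (1ℤ + (1ℤ + k))
  shift = solve-∀
... | inj₂ refl = begin
  + 2 * + suc a
    ≡⟨ double (+ a) ⟩
  + a + 0ℤ + + suc (suc a)
    ≡⟨ cong₂ (λ S σ → S + σ + + suc (suc a)) (sgnSum-above (ℕP.n<1+n a)) (sgn-[a-a]≡0 (+ suc a)) ⟨
  sgnSum (suc a) a + sgn (+ suc a - + suc a) + + suc (suc a)
    ≡⟨ cong (_+ + suc (suc a)) (sgnSum-step (suc a) a) ⟨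
  sgnSum (suc a) (suc a) + + suc (suc a) ∎
  where
  double : ∀ k → + 2 * (1ℤ + k) ≡ k + 0ℤ + (1ℤ + (1ℤ + k))
  double = solve-∀

1≤a≤n⇒a≡1+toℕ : ∀ {n} a → + 1 ℤ.≤ a → a ℤ.≤ + n → ∃ λ (u : Fin n) → a ≡ + suc (toℕ u)
1≤a≤n⇒a≡1+toℕ (+ zero)  (ℤ.+≤+ ()) _
1≤a≤n⇒a≡1+toℕ (+ suc k) _ (ℤ.+≤+ k<n) = fromℕ< k<n , cong (λ i → + suc i) (sym (FinP.toℕ-fromℕ< k<n))

∑-sgn-injective : (z : Fin n → ℤ) → Injective _≡_ _≡_ z → (∀ t → (+ 1 ℤ.≤ z t) × (z t ℤ.≤ + n)) →
                  ∀ m → + 2 * z m ≡ sum (λ t → sgn (z m - z t)) + + (n ℕ.+ 1)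
∑-sgn-injective {n} z z-inj bounds m = begin
  + 2 * z m
    ≡⟨ cong (+ 2 *_) (z≡ m) ⟩
  + 2 * + suc (toℕ (τ m))
    ≡⟨ sgnSum-within (FinP.toℕ<n (τ m)) ⟩
  sum f + + suc n
    ≡⟨ cong₂ _+_ (∑-reindex τ-inj f) (cong +_ (ℕP.+-comm n 1)) ⟨
  sum (f ∘ τ) + + (n ℕ.+ 1)
    ≡⟨ cong (_+ + (n ℕ.+ 1)) (sum-cong-≗ {n} (λ t → cong₂ (λ a b → sgn (a - b)) (z≡ m) (z≡ t))) ⟨
  sum (λ t → sgn (z m - z t)) + + (n ℕ.+ 1) ∎
  where
  τ : Fin n → Fin n
  τ t = proj₁ (1≤a≤n⇒a≡1+toℕ (z t) (proj₁ (bounds t)) (proj₂ (bounds t)))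
  z≡ : ∀ t → z t ≡ + suc (toℕ (τ t))
  z≡ t = proj₂ (1≤a≤n⇒a≡1+toℕ (z t) (proj₁ (bounds t)) (proj₂ (bounds t)))
  τ-inj : Injective _≡_ _≡_ τ
  τ-inj {t} {t′} e = z-inj (trans (z≡ t) (trans (cong (λ u → + suc (toℕ u)) e) (sym (z≡ t′))))
  f : Fin n → ℤ
  f u = sgn (+ suc (toℕ (τ m)) - + suc (toℕ u))

-- The constraint matrices

infix 8 _∙_
_∙_ : (Fin k → ℤ) → (Fin k → ℤ) → ℤ
r ∙ x = Σ (λ j → r j * x j)

sgnColumn : Matrix k → (Fin k → ℤ) → Fin k → ℤ
sgnColumn M x j = sumℤ (map (λ r → r j * sgn (r ∙ x)) M)

ᵀ·-sgnV-· : (M : Matrix k) (x : Fin k → ℤ) (j : Fin k) → (M ᵀ· sgnV (M · x)) j ≡ sgnColumn M x j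
ᵀ·-sgnV-· []      x j = refl
ᵀ·-sgnV-· (r ∷ M) x j = cong (λ q → r j * sgn (r ∙ x) + q) (ᵀ·-sgnV-· M x j)

-- Aπ n π and A n unfold to permuteColumns π (A n) and blockDiag A[ n ].

permuteColumns : Permutation′ k → Matrix k → Matrix k
permuteColumns π = map (λ r j → r (π ⟨$⟩ˡ j))

∙-permuteColumns : (π : Permutation′ k) (r x : Fin k → ℤ) →
                   (λ j → r (π ⟨$⟩ˡ j)) ∙ x ≡ r ∙ (x ∘ (π ⟨$⟩ʳ_))
∙-permuteColumns {k} π r x = begin
  (λ j → r (π ⟨$⟩ˡ j)) ∙ x
    ≡⟨ Σ≡sum (λ j → r (π ⟨$⟩ˡ j) * x j) ⟩
  sum (λ j → r (π ⟨$⟩ˡ j) * x j)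
    ≡⟨ sum-cong-≗ {k} (λ j → cong (λ i → r (π ⟨$⟩ˡ j) * x i) (Perm.inverseʳ π)) ⟨
  sum (λ j → r (π ⟨$⟩ˡ j) * x (π ⟨$⟩ʳ (π ⟨$⟩ˡ j)))
    ≡⟨ sum-permute (λ c → r c * x (π ⟨$⟩ʳ c)) (Perm.flip π) ⟨
  sum (λ c → r c * x (π ⟨$⟩ʳ c))
    ≡⟨ Σ≡sum (λ c → r c * x (π ⟨$⟩ʳ c)) ⟨
  r ∙ (x ∘ (π ⟨$⟩ʳ_)) ∎

permuteColumns-· : (π : Permutation′ k) (M : Matrix k) (x : Fin k → ℤ) →
                   permuteColumns π M · x ≡ M · (x ∘ (π ⟨$⟩ʳ_))
permuteColumns-· π M x = trans (sym (map-∘ M)) (map-cong (λ r → ∙-permuteColumns π r x) M)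

sgnColumn-permuteColumns : (π : Permutation′ k) (M : Matrix k) (x : Fin k → ℤ) (j : Fin k) →
                           sgnColumn (permuteColumns π M) x j ≡ sgnColumn M (x ∘ (π ⟨$⟩ʳ_)) (π ⟨$⟩ˡ j)
sgnColumn-permuteColumns π M x j = cong sumℤ (trans (sym (map-∘ M))
  (map-cong (λ r → cong (λ v → r (π ⟨$⟩ˡ j) * sgn v) (∙-permuteColumns π r x)) M))

blockDiag : Matrix n → Matrix (n ℕ.* n)
blockDiag M = concatMap (λ b → map (blockRow b) M) (allFin _)

blockRow-remQuot : (b : Fin n) (r : Fin n → ℤ) (c : Fin (n ℕ.* n)) →
                   blockRow b r c ≡ r (proj₂ (remQuot {n} n c)) when (proj₁ (remQuot {n} n c) ≟ᶠ b)
blockRow-remQuot {n} b r c with Fin.quotRem {n} n c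
... | (_ , b′) with b′ ≟ᶠ b
...   | yes _ = refl
...   | no  _ = refl

blockRow-combine : (b b′ m : Fin n) (r : Fin n → ℤ) → blockRow b r (combine b′ m) ≡ r m when (b′ ≟ᶠ b)
blockRow-combine {n} b b′ m r = trans (blockRow-remQuot b r (combine b′ m))
  (cong (λ q → r (proj₂ q) when (proj₁ q ≟ᶠ b)) (FinP.remQuot-combine {n} {n} b′ m))

blockRow-diag : (b m : Fin n) (r : Fin n → ℤ) → blockRow b r (combine b m) ≡ r m
blockRow-diag b m r = trans (blockRow-combine b b m r) (when-yes (b ≟ᶠ b) refl)

blockRow-off : {b b′ : Fin n} → b′ ≢ b → (m : Fin n) (r : Fin n → ℤ) → blockRow b r (combine b′ m) ≡ 0ℤ
blockRow-off {b = b} {b′} b′≢b m r = trans (blockRow-combine b b′ m r) (when-no (b′ ≟ᶠ b) b′≢b)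

blockRow-∙ : (b : Fin n) (r : Fin n → ℤ) (y : Fin (n ℕ.* n) → ℤ) →
             blockRow b r ∙ y ≡ r ∙ (y ∘ combine b)
blockRow-∙ {n} b r y = begin
  blockRow b r ∙ y
    ≡⟨ Σ≡sum (λ c → blockRow b r c * y c) ⟩
  sum (λ c → blockRow b r c * y c)
    ≡⟨ ∑-combine {n} {n} _ ⟩
  sum (λ b′ → sum (λ m → blockRow b r (combine {n} b′ m) * y (combine b′ m)))
    ≡⟨ ∑-point b off-block ⟩
  sum (λ m → blockRow b r (combine b m) * y (combine b m))
    ≡⟨ sum-cong-≗ {n} (λ m → cong (_* y (combine b m)) (blockRow-diag b m r)) ⟩
  sum (λ m → r m * y (combine b m))
    ≡⟨ Σ≡sum (λ m → r m * y (combine b m)) ⟨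
  r ∙ (y ∘ combine b) ∎
  where
  off-block : ∀ b′ → b′ ≢ b → sum (λ m → blockRow b r (combine b′ m) * y (combine b′ m)) ≡ 0ℤ
  off-block b′ b′≢b = ∑-zero (λ m → cong (_* y (combine b′ m)) (blockRow-off b′≢b m r))

blockDiag-· : (M : Matrix n) (y : Fin (n ℕ.* n) → ℤ) →
              blockDiag M · y ≡ concatMap (λ b → M · (y ∘ combine b)) (allFin n)
blockDiag-· {n} M y = trans (map-concatMap (_∙ y) (λ b → map (blockRow b) M) (allFin n))
  (concatMap-cong (λ b → trans (sym (map-∘ M)) (map-cong (λ r → blockRow-∙ b r y) M)) (allFin n))

sgnColumn-blockDiag : (M : Matrix n) (y : Fin (n ℕ.* n) → ℤ) (b m : Fin n) →
                      sgnColumn (blockDiag M) y (combine b m) ≡ sgnColumn M (y ∘ combine b) m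
sgnColumn-blockDiag {n} M y b m = begin
  sgnColumn (blockDiag M) y (combine b m)                ≡⟨ sumℤ-concatMap F (λ b′ → map (blockRow b′) M) (allFin n) ⟩
  Σ (λ b′ → sumℤ (map F (map (blockRow b′) M)))          ≡⟨ Σ≡sum (λ b′ → sumℤ (map F (map (blockRow b′) M))) ⟩
  sum (λ b′ → sumℤ (map F (map (blockRow b′) M)))        ≡⟨ ∑-point b off-block ⟩
  sumℤ (map F (map (blockRow b) M))                      ≡⟨ cong sumℤ (trans (sym (map-∘ M)) (map-cong on-block M)) ⟩
  sgnColumn M (y ∘ combine b) m                          ∎
  where
  F : (Fin (n ℕ.* n) → ℤ) → ℤ
  F R = R (combine b m) * sgn (R ∙ y)
  off-block : ∀ b′ → b′ ≢ b → sumℤ (map F (map (blockRow b′) M)) ≡ 0ℤ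
  off-block b′ b′≢b = trans (cong sumℤ (sym (map-∘ M)))
    (sumℤ-map-0 M (λ r → cong (_* sgn (blockRow b′ r ∙ y)) (blockRow-off (b′≢b ∘ sym) m r)))
  on-block : ∀ r → F (blockRow b r) ≡ r m * sgn (r ∙ (y ∘ combine b))
  on-block r = cong₂ (λ u v → u * sgn v) (blockRow-diag b m r) (blockRow-∙ b r y)

All-blockDiag-· : {P : ℤ → Set} (M : Matrix n) (y : Fin (n ℕ.* n) → ℤ) →
                  All P (blockDiag M · y) → ∀ b → All P (M · (y ∘ combine {n} b))
All-blockDiag-· {P = P} M y all =
  AllP.tabulate⁻ (AllP.map⁻ (AllP.concat⁻ (subst (All P) (blockDiag-· M y) all)))

pairRow-fst : (i k : Fin n) → pairRow (i , k) i ≡ 1ℤ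
pairRow-fst i k with i ≟ᶠ i
... | yes _   = refl
... | no i≢i = contradiction refl i≢i

pairRow-snd : {i k : Fin n} → i ≢ k → pairRow (i , k) k ≡ -1ℤ
pairRow-snd {i = i} {k} i≢k with k ≟ᶠ i
... | yes k≡i = contradiction (sym k≡i) i≢k
... | no _ with k ≟ᶠ k
...   | yes _   = refl
...   | no k≢k = contradiction refl k≢k

pairRow-other : {i k c : Fin n} → c ≢ i → c ≢ k → pairRow (i , k) c ≡ 0ℤ
pairRow-other {i = i} {k} {c} c≢i c≢k with c ≟ᶠ i
... | yes c≡i = contradiction c≡i c≢i
... | no _ with c ≟ᶠ k
...   | yes c≡k = contradiction c≡k c≢k
...   | no _    = refl

pairRow-∙ : {i k : Fin n} → i ≢ k → (z : Fin n → ℤ) → pairRow (i , k) ∙ z ≡ z i - z k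
pairRow-∙ {i = i} {k} i≢k z = begin
  pairRow (i , k) ∙ z
    ≡⟨ Σ≡sum (λ c → pairRow (i , k) c * z c) ⟩
  sum (λ c → pairRow (i , k) c * z c)
    ≡⟨ ∑-two i≢k (λ c c≢i c≢k → cong (_* z c) (pairRow-other c≢i c≢k)) ⟩
  pairRow (i , k) i * z i + pairRow (i , k) k * z k
    ≡⟨ cong₂ (λ u v → u * z i + v * z k) (pairRow-fst i k) (pairRow-snd i≢k) ⟩
  1ℤ * z i + -1ℤ * z k
    ≡⟨ difference (z i) (z k) ⟩
  z i - z k ∎
  where
  difference : ∀ a b → 1ℤ * a + -1ℤ * b ≡ a - b
  difference = solve-∀

pairRow-column : {i k : Fin n} → i ≢ k → (m : Fin n) (z : Fin n → ℤ) →
                 pairRow (i , k) m * sgn (z i - z k) ≡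
                 sgn (z m - z k) when (i ≟ᶠ m) + sgn (z m - z i) when (k ≟ᶠ m)
pairRow-column {i = i} {k} i≢k m z with i ≟ᶠ m | k ≟ᶠ m
... | yes refl | yes refl = contradiction refl i≢k
... | yes refl | no _     = trans (cong (_* sgn (z i - z k)) (pairRow-fst i k))
                                  (trans (ℤP.*-identityˡ _) (sym (ℤP.+-identityʳ _)))
... | no _     | yes refl = begin
  pairRow (i , k) k * sgn (z i - z k)   ≡⟨ cong (_* sgn (z i - z k)) (pairRow-snd i≢k) ⟩
  -1ℤ * sgn (z i - z k)                 ≡⟨ ℤP.-1*i≡-i _ ⟩
  - sgn (z i - z k)                     ≡⟨ sgn-antisym (z i) (z k) ⟨
  sgn (z k - z i)                       ≡⟨ ℤP.+-identityˡ _ ⟨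
  0ℤ + sgn (z k - z i)                  ∎
... | no i≢m   | no k≢m   = cong (_* sgn (z i - z k)) (pairRow-other (i≢m ∘ sym) (k≢m ∘ sym))

pairs-< : All (λ ik → proj₁ ik Fin.< proj₂ ik) (pairs n)
pairs-< {n} = AllP.concat⁺ (AllP.map⁺ {xs = allFin n}
  (All.tabulate (λ {i} _ → AllP.map⁺ (AllP.all-filter (i <?_) (allFin n)))))

∈-pairs : {i k : Fin n} → i Fin.< k → (i , k) ∈ₗ pairs n
∈-pairs {n} {i} {k} i<k = ∈-concatMap⁺ (λ i → map (i ,_) (filter (i <?_) (allFin n)))
  (lose (∈-allFin i) (∈-map⁺ (i ,_) (∈-filter⁺ (i <?_) (∈-allFin k) i<k)))

sumℤ-pairs : (G : Fin n × Fin n → ℤ) →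
             sumℤ (map G (pairs n)) ≡ sum (λ i → sum (λ k → G (i , k) when (i <? k)))
sumℤ-pairs {n} G = begin
  sumℤ (map G (pairs n))
    ≡⟨ sumℤ-concatMap G row (allFin n) ⟩
  Σ (λ i → sumℤ (map G (row i)))
    ≡⟨ cong sumℤ (map-cong row-sum (allFin n)) ⟩
  Σ (λ i → sum (λ k → G (i , k) when (i <? k)))
    ≡⟨ Σ≡sum (λ i → sum (λ k → G (i , k) when (i <? k))) ⟩
  sum (λ i → sum (λ k → G (i , k) when (i <? k))) ∎
  where
  row : Fin n → List (Fin n × Fin n)
  row i = map (i ,_) (filter (i <?_) (allFin n))
  row-sum : ∀ i → sumℤ (map G (row i)) ≡ sum (λ k → G (i , k) when (i <? k))
  row-sum i = trans (cong sumℤ (sym (map-∘ (filter (i <?_) (allFin n)))))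
    (trans (sumℤ-filter (i <?_) (λ k → G (i , k)) (allFin n)) (Σ≡sum (λ k → G (i , k) when (i <? k))))

sumℤ-pairs-fst : (f : Fin n → ℤ) (m : Fin n) →
                 sumℤ (map (λ ik → f (proj₂ ik) when (proj₁ ik ≟ᶠ m)) (pairs n)) ≡ sum (λ k → f k when (m <? k))
sumℤ-pairs-fst {n} f m = trans (sumℤ-pairs (λ ik → f (proj₂ ik) when (proj₁ ik ≟ᶠ m)))
  (trans (∑-point m other-rows) (sum-cong-≗ {n} (λ k → cong (_when (m <? k)) (when-yes (m ≟ᶠ m) refl))))
  where
  other-rows : ∀ i → i ≢ m → sum (λ k → f k when (i ≟ᶠ m) when (i <? k)) ≡ 0ℤ
  other-rows i i≢m =
    ∑-zero {n} (λ k → trans (cong (_when (i <? k)) (when-no (i ≟ᶠ m) i≢m)) (0-when (i <? k)))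

sumℤ-pairs-snd : (f : Fin n → ℤ) (m : Fin n) →
                 sumℤ (map (λ ik → f (proj₁ ik) when (proj₂ ik ≟ᶠ m)) (pairs n)) ≡ sum (λ i → f i when (i <? m))
sumℤ-pairs-snd {n} f m = trans (sumℤ-pairs (λ ik → f (proj₁ ik) when (proj₂ ik ≟ᶠ m)))
  (sum-cong-≗ {n} (λ i → trans (∑-point {n} m (other-columns i))
                                (cong (_when (i <? m)) (when-yes (m ≟ᶠ m) refl))))
  where
  other-columns : ∀ i k → k ≢ m → f i when (k ≟ᶠ m) when (i <? k) ≡ 0ℤ
  other-columns i k k≢m = trans (cong (_when (i <? k)) (when-no (k ≟ᶠ m) k≢m)) (0-when (i <? k))

sgnColumn-A[_] : ∀ n (z : Fin n → ℤ) (m : Fin n) → sgnColumn A[ n ] z m ≡ sum (λ t → sgn (z m - z t))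
sgnColumn-A[ n ] z m = begin
  sgnColumn A[ n ] z m
    ≡⟨ cong sumℤ (sym (map-∘ (pairs n))) ⟩
  sumℤ (map (λ ik → pairRow ik m * sgn (pairRow ik ∙ z)) (pairs n))
    ≡⟨ cong sumℤ (map-cong-local (All.map split pairs-<)) ⟩
  sumℤ (map (λ ik → G₁ ik + G₂ ik) (pairs n))
    ≡⟨ sumℤ-map-+ G₁ G₂ (pairs n) ⟩
  sumℤ (map G₁ (pairs n)) + sumℤ (map G₂ (pairs n))
    ≡⟨ cong₂ _+_ (sumℤ-pairs-fst f m) (sumℤ-pairs-snd f m) ⟩
  sum (λ t → f t when (m <? t)) + sum (λ t → f t when (t <? m))
    ≡⟨ ∑-split-around f m (sgn-[a-a]≡0 (z m)) ⟩
  sum f ∎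
  where
  f : Fin n → ℤ
  f t = sgn (z m - z t)
  G₁ G₂ : Fin n × Fin n → ℤ
  G₁ ik = f (proj₂ ik) when (proj₁ ik ≟ᶠ m)
  G₂ ik = f (proj₁ ik) when (proj₂ ik ≟ᶠ m)
  split : ∀ {ik} → proj₁ ik Fin.< proj₂ ik → pairRow ik m * sgn (pairRow ik ∙ z) ≡ G₁ ik + G₂ ik
  split {i , k} i<k = trans (cong (λ v → pairRow (i , k) m * sgn v) (pairRow-∙ (FinP.<⇒≢ i<k) z))
                            (pairRow-column (FinP.<⇒≢ i<k) m z)

A[n]·-nonzero⇒≢ : (z : Fin n → ℤ) → All (_≢ 0ℤ) (A[ n ] · z) → ∀ {i k} → i Fin.< k → z i ≢ z k
A[n]·-nonzero⇒≢ z nonzero {i} {k} i<k zi≡zk =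
  All.lookup (AllP.map⁻ (AllP.map⁻ nonzero)) (∈-pairs i<k) (begin
  pairRow (i , k) ∙ z  ≡⟨ pairRow-∙ (FinP.<⇒≢ i<k) z ⟩
  z i - z k            ≡⟨ cong (_- z k) zi≡zk ⟩
  z k - z k            ≡⟨ ℤP.+-inverseʳ (z k) ⟩
  0ℤ                   ∎)

A[n]·-nonzero⇒injective : (z : Fin n → ℤ) → All (_≢ 0ℤ) (A[ n ] · z) → Injective _≡_ _≡_ z
A[n]·-nonzero⇒injective z nonzero {a} {b} za≡zb with FinP.<-cmp a b
... | tri< a<b _ _ = contradiction za≡zb (A[n]·-nonzero⇒≢ z nonzero a<b)
... | tri≈ _ a≡b _ = a≡b
... | tri> _ _ b<a = contradiction (sym za≡zb) (A[n]·-nonzero⇒≢ z nonzero b<a)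

theorem2 : (n : ℕ) → 2 ℕ.≤ n →
  (π : Fin 3 → Permutation′ (n ℕ.* n)) →
  (I : Subset (n ℕ.* n)) → (g : Fin (n ℕ.* n) → ℤ) →
  (∀ i → i ∈ I → (+ 1 ℤ.≤ g i) × (g i ℤ.≤ + n)) →
  (x : Fin (n ℕ.* n) → ℤ) →
  (∀ i → (+ 1 ℤ.≤ x i) × (x i ℤ.≤ + n)) →
  (∀ r → All (λ y → y ≢ + 0) (Aπ n (π r) · x)) →
  (∀ i → i ∈ I → x i ≡ g i) →
  ∀ r j → + 2 ℤ.* x j ≡ (Aπ n (π r) ᵀ· sgnV (Aπ n (π r) · x)) j ℤ.+ + (n ℕ.+ 1)
theorem2 n _ π _ _ _ x bounds nonzero _ r j = begin
  + 2 * x j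
    ≡⟨ cong (λ c → + 2 * x c) x-block ⟩
  + 2 * z m
    ≡⟨ ∑-sgn-injective z z-injective (bounds ∘ (π r ⟨$⟩ʳ_) ∘ combine b) m ⟩
  sum (λ t → sgn (z m - z t)) + + (n ℕ.+ 1)
    ≡⟨ cong (_+ + (n ℕ.+ 1)) column ⟨
  (Aπ n (π r) ᵀ· sgnV (Aπ n (π r) · x)) j + + (n ℕ.+ 1) ∎
  where
  y : Fin (n ℕ.* n) → ℤ
  y = x ∘ (π r ⟨$⟩ʳ_)
  b m : Fin n
  b = proj₁ (remQuot {n} n (π r ⟨$⟩ˡ j))
  m = proj₂ (remQuot {n} n (π r ⟨$⟩ˡ j))
  z : Fin n → ℤ
  z = y ∘ combine b
  ρj≡bm : π r ⟨$⟩ˡ j ≡ combine b m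
  ρj≡bm = sym (FinP.combine-remQuot {n} n (π r ⟨$⟩ˡ j))
  x-block : j ≡ π r ⟨$⟩ʳ combine b m
  x-block = trans (sym (Perm.inverseʳ (π r))) (cong (π r ⟨$⟩ʳ_) ρj≡bm)
  z-injective : Injective _≡_ _≡_ z
  z-injective = A[n]·-nonzero⇒injective z
    (All-blockDiag-· A[ n ] y (subst (All (_≢ 0ℤ)) (permuteColumns-· (π r) (A n) x) (nonzero r)) b)
  column : (Aπ n (π r) ᵀ· sgnV (Aπ n (π r) · x)) j ≡ sum (λ t → sgn (z m - z t))
  column = begin
    (Aπ n (π r) ᵀ· sgnV (Aπ n (π r) · x)) j   ≡⟨ ᵀ·-sgnV-· (Aπ n (π r)) x j ⟩
    sgnColumn (Aπ n (π r)) x j                ≡⟨ sgnColumn-permuteColumns (π r) (A n) x j ⟩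
    sgnColumn (A n) y (π r ⟨$⟩ˡ j)            ≡⟨ cong (sgnColumn (A n) y) ρj≡bm ⟩
    sgnColumn (A n) y (combine b m)           ≡⟨ sgnColumn-blockDiag A[ n ] y b m ⟩
    sgnColumn A[ n ] z m                      ≡⟨ sgnColumn-A[ n ] z m ⟩
    sum (λ t → sgn (z m - z t))               ∎
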